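{- Let $A=\mathbb{Z}_{2^{m_1}}\times \mathbb{Z}_{2^{m_2}}\times\cdots\times\mathbb{Z}_{2^{m_k}}\times A_{2'}$, where $k\ge 1$, $m_i\ge 1$ for each $1\le i\le k$, and $A_{2'}$ is a finite abelian group of odd order. Let $H$ be a subgroup of $A$. Then $H$ is a subgroup perfect code of $A$ if and only if either $H$ is isomorphic to $\mathbb{Z}_{2^{m_1-1}}\times \mathbb{Z}_{2^{m_2-1}}\times\cdots\times\mathbb{Z}_{2^{m_k-1}}\times A_{2'}$, or $H$ contains a non-square element of $A$.
   Context: For a finite abelian group $A$ (written additively), an element $x\in A$ is a square if $x=2y$ for some $y\in A$; a subset of $A$ is square-free if it contains no squares. For a square-free subset $T\subseteq A$, the Cayley sum graph $\mathrm{CayS}(A,T)$ is the simple graph with vertex set $A$ in which distinct $x,y$ are adjacent iff $x+y\in T$. A subset $C$ of the vertex set of a graph is a perfect code if every vertex is at distance at most one from exactly one vertex of $C$ (equivalently, $C$ is independent and every vertex outside $C$ is adjacent to exactly one vertex of $C$). A subgroup $H$ of $A$ is a subgroup perfect code of $A$ if $H$ is a perfect code of $\mathrm{CayS}(A,T)$ for some square-free subset $T\subseteq A$. -}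

module Defs where

open import Level using (0ℓ)
open import Data.Nat using (ℕ; zero; suc; _^_; _∸_; _≤_)
open import Data.Nat.DivMod using (_mod_)
open import Data.Nat.Divisibility using (_∣_)
open import Data.Fin using (Fin; toℕ)
open import Data.Bool using (Bool; true)
open import Data.Unit using (⊤; tt)
open import Data.List using (List; []; _∷_; map)
open import Data.Product using (Σ; ∃; _×_; _,_; proj₁)
open import Data.Sum using (_⊎_)
open import Relation.Binary.PropositionalEquality using (_≡_; _≢_)
open import Relation.Nullary using (¬_)
open import Algebra.Structures using (IsAbelianGroup)
open import Function.Bundles using (_↔_)

record FinAbGroup : Set₁ where
  infixl 6 _+_
  field
    Carrier        : Set
    _+_            : Carrier → Carrier → Carrier
    0#             : Carrier
    -_             : Carrier → Carrier
    isAbelianGroup : IsAbelianGroup _≡_ _+_ 0# -_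
    size           : ℕ
    enum           : Fin size ↔ Carrier

record Iso {X Y : Set} (_⊕_ : X → X → X) (_⊗_ : Y → Y → Y) : Set where
  field
    bij  : X ↔ Y
  open Function.Bundles.Inverse bij public using (to)
  field
    hom  : ∀ a b → to (a ⊕ b) ≡ to a ⊗ to b

addMod : ∀ n → Fin n → Fin n → Fin n
addMod (suc n) a b = (toℕ a Data.Nat.+ toℕ b) mod suc n

Cyc2 : List ℕ → Set
Cyc2 []       = ⊤
Cyc2 (m ∷ ms) = Fin (2 ^ m) × Cyc2 ms

addCyc2 : ∀ ms → Cyc2 ms → Cyc2 ms → Cyc2 ms
addCyc2 []       tt       tt       = tt
addCyc2 (m ∷ ms) (a , as) (b , bs) = addMod (2 ^ m) a b , addCyc2 ms as bs

ProdCarrier : List ℕ → FinAbGroup → Set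
ProdCarrier ms B = Cyc2 ms × FinAbGroup.Carrier B

prodAdd : ∀ ms (B : FinAbGroup) → ProdCarrier ms B → ProdCarrier ms B → ProdCarrier ms B
prodAdd ms B (a , x) (b , y) = addCyc2 ms a b , FinAbGroup._+_ B x y

module _ (A : FinAbGroup) where
  open FinAbGroup A

  Subset : Set
  Subset = Carrier → Bool

  _∈_ : Carrier → Subset → Set
  x ∈ S = S x ≡ true

  IsSquare : Carrier → Set
  IsSquare x = ∃ λ y → y + y ≡ x

  SquareFree : Subset → Set
  SquareFree T = ∀ x → x ∈ T → ¬ IsSquare x

  -- adjacency in the Cayley sum graph CayS(A,T)
  Adj : Subset → Carrier → Carrier → Set
  Adj T x y = x ≢ y × (x + y) ∈ T

  IsPerfectCode : Subset → Subset → Set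
  IsPerfectCode T C =
    ∀ v → Σ Carrier (λ c → c ∈ C × (c ≡ v ⊎ Adj T v c)
                             × (∀ c' → c' ∈ C → (c' ≡ v ⊎ Adj T v c') → c' ≡ c))

  IsSubgroup : Subset → Set
  IsSubgroup H = 0# ∈ H × (∀ x y → x ∈ H → y ∈ H → (x + y) ∈ H)
                        × (∀ x → x ∈ H → (- x) ∈ H)

  IsSubgroupPerfectCode : Subset → Set
  IsSubgroupPerfectCode H = IsSubgroup H × ∃ λ T → SquareFree T × IsPerfectCode T H

  Elem : Subset → Set
  Elem H = Σ Carrier (λ x → x ∈ H)

  addElem : (H : Subset) → IsSubgroup H → Elem H → Elem H → Elem H
  addElem H (_ , cl , _) (x , p) (y , q) = x + y , cl x y p q

module Submission where

-- The proof has two independent halves.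
-- * A criterion valid in every finite abelian group (module PerfectCodes):
--   H is a subgroup perfect code iff every coset v + H ≠ H contains a
--   non-square.  For the converse direction the connection set T picks,
--   in each such coset, its first non-square in a fixed enumeration of A.
--   If H contains a non-square the criterion always holds; if H consists
--   of squares it holds iff H is the whole subgroup 2A of squares.
-- * The structure of 2A (module SquareSubgroup): doubling embeds R into A
--   with image 2A (injective on B because |B| is odd), so 2A ≅ R; and a
--   subgroup of 2A isomorphic to R is all of 2A by counting.

open import Level using (0ℓ)
open import Defs
open import Data.Nat using (ℕ; _≤_; _∸_)
open import Data.Nat.Divisibility using (_∣_)
open import Data.Fin as Fin using (Fin; zero; suc; toℕ; punchOut)
open import Data.Fin.Properties
  using (toℕ-injective; any?; all?) renaming (_≟_ to _≟ᶠ_; _≤?_ to _≤ᶠ?_; ≤-antisym to ≤ᶠ-antisym)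
open import Data.Bool using (true) renaming (_≟_ to _≟ᵇ_)
open import Data.List using (List; _∷_; map)
open import Data.List.Relation.Unary.All using (All)
open import Data.Product using (Σ; ∃; _×_; _,_; proj₁; proj₂)
open import Data.Sum using (_⊎_; inj₁; inj₂)
open import Data.Empty using (⊥-elim)
open import Function.Base using (_∘_)
open import Function.Bundles using (_↔_; _⇔_; Inverse; Injection; Equivalence; mk↔ₛ′; mk⇔)
open import Function.Properties.Inverse using (↔⇒↣; ↔-sym)
open import Relation.Nullary using (¬_; Dec; yes; no; does)
open import Relation.Nullary.Decidable using (map′; _×-dec_; _→-dec_; ¬?; decidable-stable; dec-true)
open import Relation.Nullary.Negation using (contradiction)
open import Relation.Unary using (Decidable)
open import Relation.Binary.Definitions using (DecidableEquality)
open import Relation.Binary.PropositionalEquality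
open import Algebra.Bundles using (AbelianGroup)
open import Algebra.Structures using (IsAbelianGroup)
open import Axiom.UniquenessOfIdentityProofs using (module Decidable⇒UIP)

module FinCounting where

  open import Data.Nat using (zero; suc; _+_; _*_; _<?_; z≤n; s≤s)
  open import Data.Nat.Properties using (<-asym; n≮n; ≤-antisym; ≮⇒≥; +-identityʳ; *-comm; +-0-commutativeMonoid)
  open import Data.Nat.Divisibility using (divides)
  open import Data.Fin.Properties using (punchOut-injective; injective⇒≤)
  open import Data.Fin.Permutation using (permutation)
  open import Algebra.Properties.CommutativeMonoid.Sum +-0-commutativeMonoid
    using (sum; sum-permute; ∑-distrib-+; sum-cong-≗)

  least-Fin : ∀ {n} {P : Fin n → Set} → Decidable P → ∃ P →
              ∃ λ i → P i × (∀ j → P j → i Fin.≤ j)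
  least-Fin {suc n} P? (i , pᵢ) with P? zero
  ... | yes p₀ = zero , p₀ , λ _ _ → z≤n
  least-Fin {suc n} P? (zero  , pᵢ) | no ¬p₀ = ⊥-elim (¬p₀ pᵢ)
  least-Fin {suc n} P? (suc i , pᵢ) | no ¬p₀ with least-Fin (P? ∘ suc) (i , pᵢ)
  ... | k , pₖ , k-least = suc k , pₖ , λ where
    zero    p₀ → ⊥-elim (¬p₀ p₀)
    (suc j) pⱼ → s≤s (k-least j pⱼ)

  -- A fixed-point-free involution pairs off the elements of Fin n, so n is
  -- even: exactly one of i, σ i is the smaller, hence counting the i with
  -- toℕ i < toℕ (σ i) counts each pair once.
  involution-even-Fin : ∀ n (σ : Fin n → Fin n) → (∀ i → σ (σ i) ≡ i) →
                        (∀ i → σ i ≢ i) → 2 ∣ n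
  involution-even-Fin n σ σσ≡id no-fix = divides (sum smaller) (begin
      n                                      ≡⟨ sym (sum-ones n) ⟩
      sum {n} (λ _ → 1)                      ≡⟨ sum-cong-≗ {n} (λ i → sym (pair i)) ⟩
      sum (λ i → smaller i + smaller (σ i))  ≡⟨ ∑-distrib-+ smaller (smaller ∘ σ) ⟩
      sum smaller + sum (smaller ∘ σ)        ≡⟨ cong (sum smaller +_) (sym (sum-permute smaller π)) ⟩
      sum smaller + sum smaller              ≡⟨ cong (sum smaller +_) (sym (+-identityʳ (sum smaller))) ⟩
      2 * sum smaller                        ≡⟨ *-comm 2 (sum smaller) ⟩
      sum smaller * 2                        ∎)
    where
    open ≡-Reasoning
    indicator : ∀ {P : Set} → Dec P → ℕ
    indicator (yes _) = 1
    indicator (no _)  = 0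
    smaller : Fin n → ℕ
    smaller i = indicator (toℕ i <? toℕ (σ i))
    sum-ones : ∀ k → sum {k} (λ _ → 1) ≡ k
    sum-ones zero    = refl
    sum-ones (suc k) = cong suc (sum-ones k)
    π = permutation σ σ σσ≡id σσ≡id
    exactly-one : ∀ a b → a ≢ b → indicator (a <? b) + indicator (b <? a) ≡ 1
    exactly-one a b a≢b with a <? b | b <? a
    ... | yes a<b | yes b<a = ⊥-elim (<-asym a<b b<a)
    ... | yes _   | no _    = refl
    ... | no _    | yes _   = refl
    ... | no a≮b  | no b≮a  = ⊥-elim (a≢b (≤-antisym (≮⇒≥ b≮a) (≮⇒≥ a≮b)))
    pair : ∀ i → smaller i + smaller (σ i) ≡ 1
    pair i rewrite σσ≡id i = exactly-one (toℕ i) (toℕ (σ i)) (λ e → no-fix i (toℕ-injective (sym e)))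

  -- Pigeonhole: an injective endomap of Fin n is surjective.  If y were
  -- missed, punching y out would give an injection Fin n → Fin (n - 1).
  injective⇒surjective-Fin : ∀ {n} (f : Fin n → Fin n) → (∀ {i j} → f i ≡ f j → i ≡ j) →
                             ∀ y → ∃ λ x → f x ≡ y
  injective⇒surjective-Fin f f-inj y with any? (λ x → f x ≟ᶠ y)
  ... | yes hit = hit
  injective⇒surjective-Fin {suc n} f f-inj y | no miss =
    contradiction (injective⇒≤ squeezed-inj) (n≮n n)
    where
    y≢f : ∀ x → y ≢ f x
    y≢f x e = miss (x , sym e)
    squeezed : Fin (suc n) → Fin n
    squeezed x = punchOut (y≢f x)
    squeezed-inj : ∀ {i j} → squeezed i ≡ squeezed j → i ≡ j
    squeezed-inj e = f-inj (punchOut-injective (y≢f _) (y≢f _) e)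

open FinCounting

to-injective : ∀ {X Y : Set} (e : X ↔ Y) {a b} → Inverse.to e a ≡ Inverse.to e b → a ≡ b
to-injective e = Injection.injective (↔⇒↣ e)

from-injective : ∀ {X Y : Set} (e : X ↔ Y) {a b} → Inverse.from e a ≡ Inverse.from e b → a ≡ b
from-injective e = to-injective (↔-sym e)

module Finite {X : Set} {n : ℕ} (enum : Fin n ↔ X) where

  index : X → Fin n
  index = Inverse.from enum

  element : Fin n → X
  element = Inverse.to enum

  element-index : ∀ x → element (index x) ≡ x
  element-index = Inverse.strictlyInverseˡ enum

  index-element : ∀ i → index (element i) ≡ i
  index-element = Inverse.strictlyInverseʳ enum

  via-index : ∀ {P : X → Set} x → P x → P (element (index x))
  via-index {P} x = subst P (sym (element-index x))

  _≟_ : DecidableEquality X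
  x ≟ y = map′ (from-injective enum) (cong index) (index x ≟ᶠ index y)

  ∃? : {P : X → Set} → Decidable P → Dec (∃ P)
  ∃? {P} P? = map′ (λ (i , p) → element i , p)
                   (λ (x , p) → index x , via-index {P} x p)
                   (any? (P? ∘ element))

  ∀? : {P : X → Set} → Decidable P → Dec (∀ x → P x)
  ∀? {P} P? = map′ (λ every x → subst P (element-index x) (every (index x)))
                   (λ every i → every (element i))
                   (all? (P? ∘ element))

  IsLeast : (X → Set) → X → Set
  IsLeast P x = P x × (∀ y → P y → index x Fin.≤ index y)

  IsLeast? : {P : X → Set} → Decidable P → Decidable (IsLeast P)
  IsLeast? P? x with P? x
  ... | no ¬p = no (¬p ∘ proj₁)
  ... | yes p = map′ (p ,_) proj₂ (∀? λ y → P? y →-dec (index x ≤ᶠ? index y))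

  least : {P : X → Set} → Decidable P → ∃ P → ∃ (IsLeast P)
  least {P} P? (x , p) with least-Fin (P? ∘ element) (index x , via-index {P} x p)
  ... | i , pᵢ , i-least = element i , pᵢ , λ y p-y →
    subst (Fin._≤ index y) (sym (index-element i)) (i-least (index y) (via-index {P} y p-y))

  least-unique : ∀ {P x y} → IsLeast P x → IsLeast P y → x ≡ y
  least-unique {x = x} {y} (p-x , x-least) (p-y , y-least) =
    from-injective enum (≤ᶠ-antisym (x-least y p-y) (y-least x p-x))

  IsLeast-resp : ∀ {P Q : X → Set} → (∀ y → P y → Q y) → (∀ y → Q y → P y) →
                 ∀ {x} → IsLeast P x → IsLeast Q x
  IsLeast-resp P⇒Q Q⇒P (p-x , x-least) = P⇒Q _ p-x , λ y q-y → x-least y (Q⇒P y q-y)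

  injective⇒surjective : (f : X → X) → (∀ {x y} → f x ≡ f y → x ≡ y) → ∀ y → ∃ λ x → f x ≡ y
  injective⇒surjective f f-inj y
    with injective⇒surjective-Fin (index ∘ f ∘ element)
           (λ e → to-injective enum (f-inj (from-injective enum e))) (index y)
  ... | i , fi≡y = element i , from-injective enum fi≡y

  involution-even : (σ : X → X) → (∀ x → σ (σ x) ≡ x) → (∀ x → σ x ≢ x) → 2 ∣ n
  involution-even σ σσ≡id no-fix = involution-even-Fin n σ′ σ′σ′≡id σ′-no-fix
    where
    σ′ : Fin n → Fin n
    σ′ = index ∘ σ ∘ element
    σ′σ′≡id : ∀ i → σ′ (σ′ i) ≡ i
    σ′σ′≡id i = begin
      index (σ (element (index (σ (element i))))) ≡⟨ cong (index ∘ σ) (element-index _) ⟩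
      index (σ (σ (element i)))                   ≡⟨ cong index (σσ≡id _) ⟩
      index (element i)                           ≡⟨ index-element i ⟩
      i                                           ∎
      where open ≡-Reasoning
    σ′-no-fix : ∀ i → σ′ i ≢ i
    σ′-no-fix i e = no-fix (element i) (from-injective enum (trans e (sym (index-element i))))

  -- An injection from the
  -- P-elements into the Q-elements forces P ⊆ Q.  (Extend the induced
  -- injection of the P-elements by the identity outside P and apply
  -- injective⇒surjective.)
  injection⇒⊆ : {P Q : X → Set} → Decidable P → (∀ x → Q x → P x) →
                (g : Σ X P → Σ X Q) → (∀ a b → proj₁ (g a) ≡ proj₁ (g b) → proj₁ a ≡ proj₁ b) →
                ∀ x → P x → Q x
  injection⇒⊆ {P} {Q} P? Q⊆P g g-inj s p-s =
    hit (injective⇒surjective (λ x → extend x (P? x)) (λ {x} {y} → extend-injective x y (P? x) (P? y)) s)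
    where
    extend : ∀ x → Dec (P x) → X
    extend x (yes p) = proj₁ (g (x , p))
    extend x (no _)  = x
    extend-injective : ∀ x y (dx : Dec (P x)) (dy : Dec (P y)) → extend x dx ≡ extend y dy → x ≡ y
    extend-injective x y (yes p) (yes q) e = g-inj (x , p) (y , q) e
    extend-injective x y (yes p) (no ¬q) e = ⊥-elim (¬q (subst P e (Q⊆P _ (proj₂ (g (x , p))))))
    extend-injective x y (no ¬p) (yes q) e = ⊥-elim (¬p (subst P (sym e) (Q⊆P _ (proj₂ (g (y , q))))))
    extend-injective x y (no _)  (no _)  e = e
    extend-in-Q : ∀ x (dx : Dec (P x)) → P (extend x dx) → Q (extend x dx)
    extend-in-Q x (yes p) _   = proj₂ (g (x , p))
    extend-in-Q x (no ¬p) p-x = ⊥-elim (¬p p-x)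
    hit : (∃ λ x → extend x (P? x) ≡ s) → Q s
    hit (x , e) = subst Q e (extend-in-Q x (P? x) (subst P (sym e) p-s))

module GroupFacts (G : FinAbGroup) where

  open FinAbGroup G public
  open IsAbelianGroup isAbelianGroup public using (assoc; comm; identityʳ; inverseʳ)
  open Finite enum public

  abelianGroup : AbelianGroup 0ℓ 0ℓ
  abelianGroup = record { isAbelianGroup = isAbelianGroup }

  open import Algebra.Properties.AbelianGroup abelianGroup public
    using (xyx⁻¹≈y; ⁻¹-∙-comm; ⁻¹-anti-homo‿-; x∙y⁻¹≈ε⇒x≈y; ∙-cancelˡ; //-rightDividesˡ; \\-leftDividesʳ)
  open import Algebra.Properties.CommutativeSemigroup (AbelianGroup.commutativeSemigroup abelianGroup) public
    using (interchange)

  _∈ᴬ_ : Carrier → Subset G → Set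
  _∈ᴬ_ = _∈_ G

  infixl 6 _-_
  _-_ : Carrier → Carrier → Carrier
  x - y = x + - y

  add-sub : ∀ x y → (x + y) - x ≡ y
  add-sub = xyx⁻¹≈y

  sub-add : ∀ x y → (x - y) + y ≡ x
  sub-add x y = //-rightDividesˡ y x

  add-sub′ : ∀ x y → x + (y - x) ≡ y
  add-sub′ x y = trans (comm x (y - x)) (sub-add y x)

  sub-sub : ∀ x y → x - (x - y) ≡ y
  sub-sub x y = trans (cong (x +_) (⁻¹-anti-homo‿- x y)) (add-sub′ x y)

  sub-sub-base : ∀ u v w → (u - v) - (w - v) ≡ u - w
  sub-sub-base u v w = begin
    (u - v) - (w - v)      ≡⟨ cong ((u - v) +_) (⁻¹-anti-homo‿- w v) ⟩
    (u - v) + (v - w)      ≡⟨ assoc u (- v) (v - w) ⟩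
    u + (- v + (v - w))    ≡⟨ cong (u +_) (\\-leftDividesʳ v (- w)) ⟩
    u - w                  ∎
    where open ≡-Reasoning

  Square : Carrier → Set
  Square = IsSquare G

  square? : Decidable Square
  square? x = ∃? (λ y → (y + y) ≟ x)

  square-+ : ∀ {x y} → Square x → Square y → Square (x + y)
  square-+ (a , refl) (b , refl) = a + b , interchange a b a b

  square-neg : ∀ {x} → Square x → Square (- x)
  square-neg (a , refl) = - a , ⁻¹-∙-comm a a

  square-sub : ∀ {x y} → Square x → Square y → Square (x - y)
  square-sub sx sy = square-+ sx (square-neg sy)

  -- In a group of odd order no element has order 2: x ↦ x + d would be a
  -- fixed-point-free involution, forcing the order to be even.
  odd⇒no-involution : ¬ (2 ∣ size) → ∀ d → d + d ≡ 0# → d ≡ 0#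
  odd⇒no-involution odd d d+d≡0 with d ≟ 0#
  ... | yes d≡0 = d≡0
  ... | no d≢0  = contradiction (involution-even (_+ d) shift-shift shift-moves) odd
    where
    shift-shift : ∀ x → (x + d) + d ≡ x
    shift-shift x = trans (assoc x d d) (trans (cong (x +_) d+d≡0) (identityʳ x))
    shift-moves : ∀ x → x + d ≢ x
    shift-moves x e = d≢0 (∙-cancelˡ x d 0# (trans e (sym (identityʳ x))))

  odd⇒double-injective : ¬ (2 ∣ size) → ∀ {b b′} → b + b ≡ b′ + b′ → b ≡ b′
  odd⇒double-injective odd {b} {b′} e = x∙y⁻¹≈ε⇒x≈y b b′ (odd⇒no-involution odd (b - b′) (begin
    (b - b′) + (b - b′)      ≡⟨ interchange b (- b′) b (- b′) ⟩
    (b + b) + (- b′ + - b′)  ≡⟨ cong ((b + b) +_) (⁻¹-∙-comm b′ b′) ⟩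
    (b + b) - (b′ + b′)      ≡⟨ cong (λ z → z - (b′ + b′)) e ⟩
    (b′ + b′) - (b′ + b′)    ≡⟨ inverseʳ (b′ + b′) ⟩
    0#                       ∎))
    where open ≡-Reasoning

does-true : ∀ {P : Set} (d : Dec P) → does d ≡ true → P
does-true (yes p) _  = p
does-true (no _)  ()

module PerfectCodes (A : FinAbGroup) (H : Subset A) (hH : IsSubgroup A H) where

  open GroupFacts A

  ∈H? : Decidable (_∈ᴬ H)
  ∈H? x = H x ≟ᵇ true

  0∈H : 0# ∈ᴬ H
  0∈H = proj₁ hH

  +-closed : ∀ {x y} → x ∈ᴬ H → y ∈ᴬ H → (x + y) ∈ᴬ H
  +-closed = proj₁ (proj₂ hH) _ _

  neg-closed : ∀ {x} → x ∈ᴬ H → (- x) ∈ᴬ H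
  neg-closed = proj₂ (proj₂ hH) _

  sub-closed : ∀ {x y} → x ∈ᴬ H → y ∈ᴬ H → (x - y) ∈ᴬ H
  sub-closed x∈H y∈H = +-closed x∈H (neg-closed y∈H)

  NonSquareIn : Carrier → Carrier → Set
  NonSquareIn v u = (u - v) ∈ᴬ H × ¬ Square u

  NonSquareIn? : ∀ v → Decidable (NonSquareIn v)
  NonSquareIn? v u = ∈H? (u - v) ×-dec ¬? (square? u)

  CosetsHaveNonSquares : Set
  CosetsHaveNonSquares = ∀ v → ¬ v ∈ᴬ H → ∃ (NonSquareIn v)

  NonSquareIn-coset : ∀ {v w u} → (w - v) ∈ᴬ H → NonSquareIn v u → NonSquareIn w u
  NonSquareIn-coset {v} {w} {u} w-v∈H (u-v∈H , ns) =
    subst (_∈ᴬ H) (sub-sub-base u v w) (sub-closed u-v∈H w-v∈H) , ns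

  coset-sym : ∀ {v w} → (w - v) ∈ᴬ H → (v - w) ∈ᴬ H
  coset-sym {v} {w} w-v∈H = subst (_∈ᴬ H) (⁻¹-anti-homo‿- w v) (neg-closed w-v∈H)

  Representative : Carrier → Set
  Representative t = ¬ t ∈ᴬ H × IsLeast (NonSquareIn t) t

  Representative? : Decidable Representative
  Representative? t = ¬? (∈H? t) ×-dec IsLeast? (NonSquareIn? t) t

  T : Subset A
  T t = does (Representative? t)

  T-representative : ∀ {t} → t ∈ᴬ T → Representative t
  T-representative {t} = does-true (Representative? t)

  T-squareFree : SquareFree A T
  T-squareFree t t∈T = proj₂ (proj₁ (proj₂ (T-representative t∈T)))

  -- Two elements of T in the same coset v + H coincide: both are the least
  -- non-square of that coset.
  T-unique : ∀ {v t t′} → (t - v) ∈ᴬ H → (t′ - v) ∈ᴬ H → t ∈ᴬ T → t′ ∈ᴬ T → t ≡ t′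
  T-unique {v} {t} {t′} t-v∈H t′-v∈H t∈T t′∈T =
    least-unique (least-for-v t-v∈H (proj₂ (T-representative t∈T)))
                 (least-for-v t′-v∈H (proj₂ (T-representative t′∈T)))
    where
    least-for-v : ∀ {s} → (s - v) ∈ᴬ H → IsLeast (NonSquareIn s) s → IsLeast (NonSquareIn v) s
    least-for-v s-v∈H = IsLeast-resp (λ _ → NonSquareIn-coset (coset-sym s-v∈H))
                                     (λ _ → NonSquareIn-coset s-v∈H)

  T-meets-coset : ∀ {v} → ¬ v ∈ᴬ H → ∃ (NonSquareIn v) → ∃ λ t → (t - v) ∈ᴬ H × t ∈ᴬ T
  T-meets-coset {v} v∉H has-ns with least (NonSquareIn? v) has-ns
  ... | t , t-least@((t-v∈H , _) , _) =
    t , t-v∈H , dec-true (Representative? t) (t∉H , t-least′)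
    where
    t∉H : ¬ t ∈ᴬ H
    t∉H t∈H = v∉H (subst (_∈ᴬ H) (sub-sub t v) (sub-closed t∈H t-v∈H))
    t-least′ : IsLeast (NonSquareIn t) t
    t-least′ = IsLeast-resp (λ _ → NonSquareIn-coset t-v∈H)
                            (λ _ → NonSquareIn-coset (coset-sym t-v∈H)) t-least

  Near : Carrier → Carrier → Set
  Near v c = c ≡ v ⊎ Adj A T v c

  UniqueCodeword : Carrier → Set
  UniqueCodeword v = Σ Carrier λ c → c ∈ᴬ H × Near v c × (∀ c′ → c′ ∈ᴬ H → Near v c′ → c′ ≡ c)

  -- A member of H is near no other member: v + c′ ∈ H, but T avoids H.
  codeword-member : ∀ {v} → v ∈ᴬ H → UniqueCodeword v
  codeword-member {v} v∈H = v , v∈H , inj₁ refl , only-v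
    where
    only-v : ∀ c′ → c′ ∈ᴬ H → Near v c′ → c′ ≡ v
    only-v _  _    (inj₁ c′≡v)          = c′≡v
    only-v c′ c′∈H (inj₂ (_ , v+c′∈T)) = ⊥-elim (proj₁ (T-representative v+c′∈T) (+-closed v∈H c′∈H))

  -- A non-member v is near exactly t - v, where t is the element of T in v + H.
  codeword-nonmember : ∀ {v} → ¬ v ∈ᴬ H → ∃ (NonSquareIn v) → UniqueCodeword v
  codeword-nonmember {v} v∉H has-ns with T-meets-coset v∉H has-ns
  ... | t , t-v∈H , t∈T = t - v , t-v∈H , inj₂ (v≢t-v , subst (_∈ᴬ T) (sym (add-sub′ v t)) t∈T) , only-t-v
    where
    v≢t-v : v ≢ t - v
    v≢t-v v≡t-v = v∉H (subst (_∈ᴬ H) (sym v≡t-v) t-v∈H)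
    only-t-v : ∀ c′ → c′ ∈ᴬ H → Near v c′ → c′ ≡ t - v
    only-t-v c′ c′∈H (inj₁ refl)         = ⊥-elim (v∉H c′∈H)
    only-t-v c′ c′∈H (inj₂ (_ , v+c′∈T)) = ∙-cancelˡ v c′ (t - v) (begin
      v + c′       ≡⟨ T-unique (subst (_∈ᴬ H) (sym (add-sub v c′)) c′∈H) t-v∈H v+c′∈T t∈T ⟩
      t            ≡⟨ sym (add-sub′ v t) ⟩
      v + (t - v)  ∎)
      where open ≡-Reasoning

  cosets⇒perfectCode : CosetsHaveNonSquares → IsPerfectCode A T H
  cosets⇒perfectCode has-ns v with ∈H? v
  ... | yes v∈H = codeword-member v∈H
  ... | no v∉H  = codeword-nonmember v∉H (has-ns v v∉H)

  -- Conversely, if H is a perfect code of CayS(A, T′), a vertex v ∉ H is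
  -- adjacent to some c ∈ H, and v + c is a non-square of v + H.
  perfectCode⇒cosets : ∀ {T′} → SquareFree A T′ → IsPerfectCode A T′ H → CosetsHaveNonSquares
  perfectCode⇒cosets {T′} T′-sf T′-pc v v∉H with T′-pc v
  ... | c , c∈H , inj₁ refl            , _ = ⊥-elim (v∉H c∈H)
  ... | c , c∈H , inj₂ (_ , v+c∈T′) , _ =
    v + c , subst (_∈ᴬ H) (sym (add-sub v c)) c∈H , T′-sf (v + c) v+c∈T′

  perfectCode⇔cosets : IsSubgroupPerfectCode A H ⇔ CosetsHaveNonSquares
  perfectCode⇔cosets = mk⇔ (λ (_ , T′ , T′-sf , T′-pc) → perfectCode⇒cosets T′-sf T′-pc)
                           (λ has-ns → hH , T , T-squareFree , cosets⇒perfectCode has-ns)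

  NonSquareMember : Set
  NonSquareMember = ∃ λ h → h ∈ᴬ H × ¬ Square h

  nonSquareMember? : Dec NonSquareMember
  nonSquareMember? = ∃? (λ h → ∈H? h ×-dec ¬? (square? h))

  members-square : ¬ NonSquareMember → ∀ x → x ∈ᴬ H → Square x
  members-square no-ns x x∈H = decidable-stable (square? x) (λ x-ns → no-ns (x , x∈H , x-ns))

  v-v∈H : ∀ v → (v - v) ∈ᴬ H
  v-v∈H v = subst (_∈ᴬ H) (sym (inverseʳ v)) 0∈H

  -- A non-square h ∈ H puts a non-square in every coset: v or v + h.
  nonSquareMember⇒cosets : NonSquareMember → CosetsHaveNonSquares
  nonSquareMember⇒cosets (h , h∈H , h-ns) v _ with square? v
  ... | no v-ns  = v , v-v∈H v , v-ns
  ... | yes v-sq = v + h , subst (_∈ᴬ H) (sym (add-sub v h)) h∈H ,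
                   λ v+h-sq → h-ns (subst Square (add-sub v h) (square-sub v+h-sq v-sq))

  squares⊆⇒cosets : (∀ x → Square x → x ∈ᴬ H) → CosetsHaveNonSquares
  squares⊆⇒cosets sq⊆H v v∉H = v , v-v∈H v , λ v-sq → v∉H (sq⊆H v v-sq)

  -- If H consists of squares, a coset s + H of a square s is made of
  -- squares, so the criterion forces every square into H.
  cosets⇒squares⊆ : (∀ x → x ∈ᴬ H → Square x) → CosetsHaveNonSquares → ∀ s → Square s → s ∈ᴬ H
  cosets⇒squares⊆ H⊆sq has-ns s s-sq = decidable-stable (∈H? s) λ s∉H → not-square (has-ns s s∉H)
    where
    not-square : ¬ ∃ (NonSquareIn s)
    not-square (u , u-s∈H , u-ns) = u-ns (subst Square (sub-add u s) (square-+ (H⊆sq _ u-s∈H) s-sq))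

module ResidueDoubling where

  open import Data.Nat using (suc; _+_; _*_; _^_; z≤n; s≤s; NonZero)
  open import Data.Nat.Properties using (*-comm; *-distribˡ-+; *-monoʳ-<; *-cancelˡ-≡; +-identityʳ; m≤m+n)
  open import Data.Nat.DivMod using (_%_; _mod_; m%n*o≡m*o%[n*o]; m%n<n; m<n⇒m%n≡m)
  open import Data.Fin using (fromℕ<; inject≤)
  open import Data.Fin.Properties using (toℕ-fromℕ<; toℕ-inject≤; toℕ<n)
  open import Data.List using ([])
  open import Data.List.Relation.Unary.All using ([]; _∷_)
  open import Data.Unit using (tt)

  double-% : ∀ x n → 2 * (x % suc n) ≡ (2 * x) % (2 * suc n)
  double-% x n = begin
    2 * (x % suc n)        ≡⟨ *-comm 2 (x % suc n) ⟩
    x % suc n * 2          ≡⟨ m%n*o≡m*o%[n*o] x (suc n) 2 ⟩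
    x * 2 % (suc n * 2)    ≡⟨ %-cong (*-comm x 2) (*-comm (suc n) 2) ⟩
    2 * x % (2 * suc n)    ∎
    where
    open ≡-Reasoning
    %-cong : ∀ {a b c d} .{{_ : NonZero c}} .{{_ : NonZero d}} → a ≡ b → c ≡ d → a % c ≡ b % d
    %-cong refl refl = refl

  toℕ-addMod : ∀ n (a b : Fin (suc n)) → toℕ (addMod (suc n) a b) ≡ (toℕ a + toℕ b) % suc n
  toℕ-addMod n a b = toℕ-fromℕ< _

  double : ∀ M → Fin M → Fin (2 * M)
  double M a = fromℕ< (*-monoʳ-< 2 (toℕ<n a))

  toℕ-double : ∀ M a → toℕ (double M a) ≡ 2 * toℕ a
  toℕ-double M a = toℕ-fromℕ< _

  double-hom : ∀ M a b → double M (addMod M a b) ≡ addMod (2 * M) (double M a) (double M b)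
  double-hom (suc n) a b = toℕ-injective (begin
    toℕ (double M (addMod M a b))          ≡⟨ toℕ-double M (addMod M a b) ⟩
    2 * toℕ (addMod M a b)                 ≡⟨ cong (2 *_) (toℕ-addMod n a b) ⟩
    2 * ((toℕ a + toℕ b) % M)              ≡⟨ double-% (toℕ a + toℕ b) n ⟩
    2 * (toℕ a + toℕ b) % (2 * M)          ≡⟨ cong (_% (2 * M)) (*-distribˡ-+ 2 (toℕ a) (toℕ b)) ⟩
    (2 * toℕ a + 2 * toℕ b) % (2 * M)      ≡⟨ cong₂ (λ u v → (u + v) % (2 * M))
                                                    (sym (toℕ-double M a)) (sym (toℕ-double M b)) ⟩
    (toℕ 2a + toℕ 2b) % (2 * M)            ≡⟨ sym (toℕ-addMod _ 2a 2b) ⟩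
    toℕ (addMod (2 * M) 2a 2b)             ∎)
    where
    open ≡-Reasoning
    M = suc n
    2a = double M a
    2b = double M b

  double-injective : ∀ M {a b} → double M a ≡ double M b → a ≡ b
  double-injective M {a} {b} e = toℕ-injective (*-cancelˡ-≡ (toℕ a) (toℕ b) 2
    (trans (sym (toℕ-double M a)) (trans (cong toℕ e) (toℕ-double M b))))

  widen : ∀ M → Fin M → Fin (2 * M)
  widen M a = inject≤ a (m≤m+n M (M + 0))

  halve : ∀ M → Fin (2 * M) → Fin M
  halve (suc n) c = toℕ c mod suc n

  -- 2a = a + a in ℤ_{2M}, as a < M causes no wrap-around.
  double-is-square : ∀ M a → double M a ≡ addMod (2 * M) (widen M a) (widen M a)
  double-is-square (suc n) a = toℕ-injective (begin
    toℕ (double (suc n) a)      ≡⟨ toℕ-double (suc n) a ⟩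
    2 * toℕ a                   ≡⟨ sym (m<n⇒m%n≡m (*-monoʳ-< 2 (toℕ<n a))) ⟩
    2 * toℕ a % (2 * suc n)     ≡⟨ cong₂ (λ u v → (u + v) % (2 * suc n))
                                         (sym (toℕ-inject≤ a _)) (trans (+-identityʳ (toℕ a)) (sym (toℕ-inject≤ a _))) ⟩
    (toℕ a′ + toℕ a′) % (2 * suc n)          ≡⟨ sym (toℕ-addMod _ a′ a′) ⟩
    toℕ (addMod (2 * suc n) a′ a′)           ∎)
    where
    open ≡-Reasoning
    a′ = widen (suc n) a

  square-is-double : ∀ M c → addMod (2 * M) c c ≡ double M (halve M c)
  square-is-double (suc n) c = toℕ-injective (begin
    toℕ (addMod (2 * suc n) c c)            ≡⟨ toℕ-addMod _ c c ⟩
    (toℕ c + toℕ c) % (2 * suc n)           ≡⟨ cong (λ z → (toℕ c + z) % (2 * suc n)) (sym (+-identityʳ (toℕ c))) ⟩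
    2 * toℕ c % (2 * suc n)                 ≡⟨ sym (double-% (toℕ c) n) ⟩
    2 * (toℕ c % suc n)                     ≡⟨ cong (2 *_) (sym (toℕ-fromℕ< (m%n<n (toℕ c) (suc n)))) ⟩
    2 * toℕ (toℕ c mod suc n)               ≡⟨ sym (toℕ-double (suc n) (halve (suc n) c)) ⟩
    toℕ (double (suc n) (halve (suc n) c))  ∎)
    where open ≡-Reasoning

  -- The same maps, componentwise, between ℤ_{2^{m₁-1}} × ⋯ × ℤ_{2^{mₖ-1}}
  -- and ℤ_{2^{m₁}} × ⋯ × ℤ_{2^{mₖ}} (all mᵢ ≥ 1, so 2^{mᵢ} = 2 · 2^{mᵢ-1}).
  Halved : List ℕ → Set
  Halved ms = Cyc2 (map (_∸ 1) ms)

  doubleᶜ : ∀ ms → All (1 ≤_) ms → Halved ms → Cyc2 ms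
  doubleᶜ []           []              tt       = tt
  doubleᶜ (suc m ∷ ms) (s≤s z≤n ∷ pos) (a , as) = double (2 ^ m) a , doubleᶜ ms pos as

  widenᶜ : ∀ ms → All (1 ≤_) ms → Halved ms → Cyc2 ms
  widenᶜ []           []              tt       = tt
  widenᶜ (suc m ∷ ms) (s≤s z≤n ∷ pos) (a , as) = widen (2 ^ m) a , widenᶜ ms pos as

  halveᶜ : ∀ ms → All (1 ≤_) ms → Cyc2 ms → Halved ms
  halveᶜ []           []              tt       = tt
  halveᶜ (suc m ∷ ms) (s≤s z≤n ∷ pos) (c , cs) = halve (2 ^ m) c , halveᶜ ms pos cs

  doubleᶜ-hom : ∀ ms pos a b →
    doubleᶜ ms pos (addCyc2 (map (_∸ 1) ms) a b) ≡ addCyc2 ms (doubleᶜ ms pos a) (doubleᶜ ms pos b)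
  doubleᶜ-hom []           []              tt       tt       = refl
  doubleᶜ-hom (suc m ∷ ms) (s≤s z≤n ∷ pos) (a , as) (b , bs) =
    cong₂ _,_ (double-hom (2 ^ m) a b) (doubleᶜ-hom ms pos as bs)

  doubleᶜ-injective : ∀ ms pos {a b} → doubleᶜ ms pos a ≡ doubleᶜ ms pos b → a ≡ b
  doubleᶜ-injective []           []              {tt}     {tt}     _ = refl
  doubleᶜ-injective (suc m ∷ ms) (s≤s z≤n ∷ pos) {a , as} {b , bs} e =
    cong₂ _,_ (double-injective (2 ^ m) (cong proj₁ e)) (doubleᶜ-injective ms pos (cong proj₂ e))

  doubleᶜ-is-square : ∀ ms pos a → doubleᶜ ms pos a ≡ addCyc2 ms (widenᶜ ms pos a) (widenᶜ ms pos a)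
  doubleᶜ-is-square []           []              tt       = refl
  doubleᶜ-is-square (suc m ∷ ms) (s≤s z≤n ∷ pos) (a , as) =
    cong₂ _,_ (double-is-square (2 ^ m) a) (doubleᶜ-is-square ms pos as)

  square-is-doubleᶜ : ∀ ms pos c → addCyc2 ms c c ≡ doubleᶜ ms pos (halveᶜ ms pos c)
  square-is-doubleᶜ []           []              tt       = refl
  square-is-doubleᶜ (suc m ∷ ms) (s≤s z≤n ∷ pos) (c , cs) =
    cong₂ _,_ (square-is-double (2 ^ m) c) (square-is-doubleᶜ ms pos cs)

open ResidueDoubling

-- An element of a subset is determined by its underlying element, since
-- membership proofs (equations between booleans) are unique.
Elem-≡ : ∀ (A : FinAbGroup) (S : Subset A) {a b : Elem A S} → proj₁ a ≡ proj₁ b → a ≡ b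
Elem-≡ A S {x , p} {.x , q} refl = cong (x ,_) (Decidable⇒UIP.≡-irrelevant _≟ᵇ_ p q)

module SquareSubgroup (A : FinAbGroup) (ms : List ℕ) (B : FinAbGroup) (pos : All (1 ≤_) ms)
                      (odd : ¬ (2 ∣ FinAbGroup.size B)) (φ : Iso (FinAbGroup._+_ A) (prodAdd ms B)) where

  open GroupFacts A
  private module B = GroupFacts B

  P R : Set
  P = ProdCarrier ms B
  R = ProdCarrier (map (_∸ 1) ms) B

  _⊕_ : P → P → P
  _⊕_ = prodAdd ms B

  _⊞_ : R → R → R
  _⊞_ = prodAdd (map (_∸ 1) ms) B

  ψ : R → P
  ψ (a , b) = doubleᶜ ms pos a , b B.+ b

  ψ-hom : ∀ r s → ψ (r ⊞ s) ≡ ψ r ⊕ ψ s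
  ψ-hom (a , b) (a′ , b′) = cong₂ _,_ (doubleᶜ-hom ms pos a a′) (B.interchange b b′ b b′)

  -- ψ is injective: on B because |B| is odd.
  ψ-injective : ∀ {r s} → ψ r ≡ ψ s → r ≡ s
  ψ-injective {a , b} {a′ , b′} e =
    cong₂ _,_ (doubleᶜ-injective ms pos (cong proj₁ e)) (B.odd⇒double-injective odd (cong proj₂ e))

  widenᴾ : R → P
  widenᴾ (a , b) = widenᶜ ms pos a , b

  halveᴾ : P → R
  halveᴾ (c , e) = halveᶜ ms pos c , e

  ψ-is-square : ∀ r → ψ r ≡ widenᴾ r ⊕ widenᴾ r
  ψ-is-square (a , b) = cong (_, b B.+ b) (doubleᶜ-is-square ms pos a)

  square-is-ψ : ∀ q → q ⊕ q ≡ ψ (halveᴾ q)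
  square-is-ψ (c , e) = cong (_, e B.+ e) (square-is-doubleᶜ ms pos c)

  to : Carrier → P
  to = Iso.to φ

  from : P → Carrier
  from = Inverse.from (Iso.bij φ)

  to-from : ∀ p → to (from p) ≡ p
  to-from = Inverse.strictlyInverseˡ (Iso.bij φ)

  from-to : ∀ x → from (to x) ≡ x
  from-to = Inverse.strictlyInverseʳ (Iso.bij φ)

  from-hom : ∀ p q → from (p ⊕ q) ≡ from p + from q
  from-hom p q = begin
    from (p ⊕ q)                      ≡⟨ cong₂ (λ u v → from (u ⊕ v)) (sym (to-from p)) (sym (to-from q)) ⟩
    from (to (from p) ⊕ to (from q))  ≡⟨ cong from (sym (Iso.hom φ (from p) (from q))) ⟩
    from (to (from p + from q))       ≡⟨ from-to (from p + from q) ⟩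
    from p + from q                   ∎
    where open ≡-Reasoning

  embed : R → Carrier
  embed r = from (ψ r)

  embed-hom : ∀ r s → embed (r ⊞ s) ≡ embed r + embed s
  embed-hom r s = trans (cong from (ψ-hom r s)) (from-hom (ψ r) (ψ s))

  embed-injective : ∀ {r s} → embed r ≡ embed s → r ≡ s
  embed-injective e = ψ-injective (from-injective (Iso.bij φ) e)

  embed-square : ∀ r → Square (embed r)
  embed-square r = from (widenᴾ r) , sym (trans (cong from (ψ-is-square r)) (from-hom _ _))

  square-embed : ∀ {x} → Square x → ∃ λ r → embed r ≡ x
  square-embed (y , refl) = halveᴾ (to y) , (begin
    from (ψ (halveᴾ (to y)))  ≡⟨ cong from (sym (square-is-ψ (to y))) ⟩
    from (to y ⊕ to y)        ≡⟨ cong from (sym (Iso.hom φ y y)) ⟩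
    from (to (y + y))         ≡⟨ from-to (y + y) ⟩
    y + y                     ∎)
    where open ≡-Reasoning

  module _ (H : Subset A) (hH : IsSubgroup A H) where

    squares≅halved : (∀ x → x ∈ᴬ H → Square x) → (∀ x → Square x → x ∈ᴬ H) →
                     Iso (addElem A H hH) _⊞_
    squares≅halved H⊆sq sq⊆H = record
      { bij = mk↔ₛ′ root (λ r → embed r , sq⊆H _ (embed-square r))
                    (λ r → embed-injective (root-spec (embed r , _)))
                    (λ e → Elem-≡ A H (root-spec e))
      ; hom = λ a b → embed-injective (begin
          embed (root (addElem A H hH a b))  ≡⟨ root-spec (addElem A H hH a b) ⟩
          proj₁ a + proj₁ b                  ≡⟨ cong₂ _+_ (sym (root-spec a)) (sym (root-spec b)) ⟩
          embed (root a) + embed (root b)    ≡⟨ sym (embed-hom (root a) (root b)) ⟩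
          embed (root a ⊞ root b)            ∎)
      }
      where
      open ≡-Reasoning
      root : Elem A H → R
      root (x , x∈H) = proj₁ (square-embed (H⊆sq x x∈H))
      root-spec : ∀ e → embed (root e) ≡ proj₁ e
      root-spec (x , x∈H) = proj₂ (square-embed (H⊆sq x x∈H))

    -- Counting: if H consists of squares and H ≅ R, then H contains all
    -- squares, since the squares are also in bijection with R.
    halved≅⇒squares⊆ : Iso (addElem A H hH) _⊞_ → (∀ x → x ∈ᴬ H → Square x) →
                       ∀ x → Square x → x ∈ᴬ H
    halved≅⇒squares⊆ J H⊆sq = injection⇒⊆ square? H⊆sq g g-injective
      where
      g : Σ Carrier Square → Elem A H
      g (x , x-sq) = Inverse.from (Iso.bij J) (proj₁ (square-embed x-sq))
      g-injective : ∀ a b → proj₁ (g a) ≡ proj₁ (g b) → proj₁ a ≡ proj₁ b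
      g-injective (x , x-sq) (y , y-sq) e = begin
        x                                  ≡⟨ sym (proj₂ (square-embed x-sq)) ⟩
        embed (proj₁ (square-embed x-sq))  ≡⟨ cong embed (from-injective (Iso.bij J) (Elem-≡ A H e)) ⟩
        embed (proj₁ (square-embed y-sq))  ≡⟨ proj₂ (square-embed y-sq) ⟩
        y                                  ∎
        where open ≡-Reasoning

theorem3p1 : (A : FinAbGroup) (m : ℕ) (ms : List ℕ) (B : FinAbGroup) →
    All (1 ≤_) (m ∷ ms) → ¬ (2 ∣ FinAbGroup.size B) →
    Iso (FinAbGroup._+_ A) (prodAdd (m ∷ ms) B) →
    (H : Subset A) (hH : IsSubgroup A H) →
    IsSubgroupPerfectCode A H
      ⇔ (Iso (addElem A H hH) (prodAdd (map (_∸ 1) (m ∷ ms)) B)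
         ⊎ ∃ (λ x → _∈_ A x H × ¬ IsSquare A x))
theorem3p1 A m ms B pos odd φ H hH = mk⇔ forward backward
  where
  open PerfectCodes A H hH
  open SquareSubgroup A (m ∷ ms) B pos odd φ using (_⊞_; squares≅halved; halved≅⇒squares⊆)
  open Equivalence perfectCode⇔cosets renaming (to to cosets; from to perfectCode)

  -- If H contains no non-square, the criterion says H is the subgroup of
  -- squares, which is isomorphic to R.
  forward : IsSubgroupPerfectCode A H → Iso (addElem A H hH) _⊞_ ⊎ NonSquareMember
  forward pc with nonSquareMember?
  ... | yes ns   = inj₂ ns
  ... | no no-ns = inj₁ (squares≅halved H hH (members-square no-ns)
                           (cosets⇒squares⊆ (members-square no-ns) (cosets pc)))

  -- A subgroup of squares isomorphic to R contains all squares.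
  backward : Iso (addElem A H hH) _⊞_ ⊎ NonSquareMember → IsSubgroupPerfectCode A H
  backward (inj₂ ns) = perfectCode (nonSquareMember⇒cosets ns)
  backward (inj₁ J) with nonSquareMember?
  ... | yes ns   = perfectCode (nonSquareMember⇒cosets ns)
  ... | no no-ns = perfectCode (squares⊆⇒cosets (halved≅⇒squares⊆ H hH J (members-square no-ns)))
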